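{- The deque machine $\mathcal D_0$ defined below is constant-delay and prefix-Hamiltonian. $\mathcal D_0$ has states $\{\downarrow,\uparrow\}\times\{\mathsf{Even},\mathsf{Odd}\}\cup\{q_{\mathrm i}\}$ (no reachable halting state), initial state $q_{\mathrm i}$, and output states $\{q_{\mathrm i},(\downarrow,\mathsf{Even}),(\uparrow,\mathsf{Odd})\}$. Writing $\overline{\mathsf{Even}}=\mathsf{Odd}$, $\overline{\mathsf{Odd}}=\mathsf{Even}$, its transitions, for $p\in\{\mathsf{Even},\mathsf{Odd}\}$, are: (1) in $q_{\mathrm i}$, if the last bit is $0$: replace the last bit by $1$ (pop right, push $1$ right), go to $(\downarrow,\mathsf{Even})$; (2) in $(\downarrow,p)$, if the first bit is $0$: pop left and push $0$ on the right, go to $(\downarrow,\bar p)$; (3) in $(\downarrow,p)$, if the first bit is $1$: leave the word unchanged, go to $(\uparrow,p)$; (4) in $(\uparrow,p)$, if the last bit is $0$: replace the last bit by $1$, go to $(\downarrow,p)$; (5) in $(\uparrow,p)$, if the last bit is $1$: pop right and push $0$ on the left, go to $(\uparrow,\bar p)$.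
   Context: A deque machine has a finite set of states (initial state $q_{\mathrm i}$, output states, possibly a halting state) and stores a nonempty binary word; at each step, based on the state and on the first and last bits of the word, it pops one symbol at one endpoint and pushes one symbol at one endpoint (if the same endpoint, this overwrites that endpoint symbol; the length is unchanged) and changes state. For a length $\ell\ge1$ the run starts with state $q_{\mathrm i}$ and word $0^\ell$; whenever the state is an output state, the current word is produced in unit time. The machine is prefix-Hamiltonian if for every $\ell\ge1$ the first $2^\ell$ produced words are exactly the words of $\{0,1\}^\ell$, each once (afterwards the run may continue indefinitely and produce repeated words). It is constant-delay if there is a constant $B$ independent of $\ell$ such that, for every $\ell$, over the entire run the number of steps before the first output and between any two consecutive outputs (and between the last output and halting, if it halts) is at most $B$. -}

module Defs where

open import Data.Bool using (Bool; true; false)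
open import Data.Nat using (ℕ; zero; suc; _+_; _≤_; _^_)
open import Data.Maybe using (Maybe; just; nothing; _>>=_)
open import Data.Product using (_×_; _,_; ∃; ∃-syntax)
open import Data.Sum using (_⊎_)
open import Data.List using (List; []; _∷_; _++_; length)
open import Data.List.Membership.Propositional using (_∈_)
open import Data.List.Relation.Unary.Unique.Propositional using (Unique)
open import Data.Vec using (Vec; _∷_; head; last; init; _∷ʳ_; replicate)
open import Relation.Binary.PropositionalEquality using (_≡_)

-- Bits: false = 0, true = 1.
Bit : Set
Bit = Bool

data Side : Set where
  left right : Side

record Op : Set where
  constructor op
  field
    popSide  : Side
    pushSide : Side
    pushBit  : Bit

pop : ∀ {k} → Side → Vec Bit (suc k) → Vec Bit k
pop left  (x ∷ xs) = xs
pop right v        = init v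

push : ∀ {k} → Side → Bit → Vec Bit k → Vec Bit (suc k)
push left  b v = b ∷ v
push right b v = v ∷ʳ b

applyOp : ∀ {k} → Op → Vec Bit (suc k) → Vec Bit (suc k)
applyOp (op s t b) w = push t b (pop s w)

-- A deque machine.  The transition function reads the state and the
-- first and last bits of the word; 'nothing' means the machine halts
-- (a halting state is one with no transitions).
record DequeMachine : Set₁ where
  field
    Q      : Set
    states : List Q
    finite : ∀ q → q ∈ states
    qi     : Q
    isOut  : Q → Bool
    δ      : Q → Bit → Bit → Maybe (Op × Q)

module _ (M : DequeMachine) where
  open DequeMachine M

  Config : ℕ → Set
  Config k = Q × Vec Bit (suc k)

  step : ∀ {k} → Config k → Maybe (Config k)
  step (q , w) with δ q (head w) (last w)
  ... | nothing       = nothing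
  ... | just (o , q') = just (q' , applyOp o w)

  -- configuration after t steps of the run on a word of length ℓ = suc k
  -- (nothing once the machine has halted)
  run : (k : ℕ) → ℕ → Maybe (Config k)
  run k zero    = just (qi , replicate (suc k) false)
  run k (suc t) = run k t >>= step

  producedAt : ∀ {k} → Maybe (Config k) → List (Vec Bit (suc k))
  producedAt nothing = []
  producedAt (just (q , w)) with isOut q
  ... | true  = w ∷ []
  ... | false = []

  outputs : (k : ℕ) → ℕ → List (Vec Bit (suc k))
  outputs k zero    = []
  outputs k (suc t) = outputs k t ++ producedAt (run k t)

  OutputAt : (k t : ℕ) → Set
  OutputAt k t = ∃[ q ] ∃[ w ] (run k t ≡ just (q , w) × isOut q ≡ true)

  HaltedAt : (k t : ℕ) → Set
  HaltedAt k t = ∃[ c ] (run k t ≡ just c × step c ≡ nothing)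

  Alive : (k t : ℕ) → Set
  Alive k t = ∃[ c ] (run k t ≡ just c)

  PrefixHamiltonian : Set
  PrefixHamiltonian =
    ∀ k → ∃[ t ] (length (outputs k t) ≡ 2 ^ suc k
                  × Unique (outputs k t)
                  × (∀ (w : Vec Bit (suc k)) → w ∈ outputs k t))

  ConstantDelay : Set
  ConstantDelay =
    ∃[ B ] ∀ k t → Alive k t →
      ∃[ s ] (t ≤ s × s ≤ t + B × (OutputAt k s ⊎ HaltedAt k s))

data Dir : Set where
  ↓ ↑ : Dir

data Parity : Set where
  Even Odd : Parity

flip : Parity → Parity
flip Even = Odd
flip Odd  = Even

data Q₀ : Set where
  qᵢ  : Q₀
  st : Dir → Parity → Q₀

isOut₀ : Q₀ → Bool
isOut₀ qᵢ          = true
isOut₀ (st ↓ Even) = true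
isOut₀ (st ↑ Odd)  = true
isOut₀ (st ↓ Odd)  = false
isOut₀ (st ↑ Even) = false

δ₀ : Q₀ → Bit → Bit → Maybe (Op × Q₀)
δ₀ qᵢ        _     false = just (op right right true , st ↓ Even)
δ₀ qᵢ        _     true  = nothing
δ₀ (st ↓ p) false _     = just (op left right false , st ↓ (flip p))
δ₀ (st ↓ p) true  _     = just (op left left true , st ↑ p)          -- (3) word unchanged
δ₀ (st ↑ p) _     false = just (op right right true , st ↓ p)
δ₀ (st ↑ p) _     true  = just (op right left false , st ↑ (flip p))

states₀ : List Q₀
states₀ = qᵢ ∷ st ↓ Even ∷ st ↓ Odd ∷ st ↑ Even ∷ st ↑ Odd ∷ []

open import Data.List.Relation.Unary.Any using (here; there)
open import Relation.Binary.PropositionalEquality using (refl)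

finite₀ : ∀ q → q ∈ states₀
finite₀ qᵢ          = here refl
finite₀ (st ↓ Even) = there (here refl)
finite₀ (st ↓ Odd)  = there (there (here refl))
finite₀ (st ↑ Even) = there (there (there (here refl)))
finite₀ (st ↑ Odd)  = there (there (there (there (here refl))))

D₀ : DequeMachine
D₀ = record
  { Q = Q₀ ; states = states₀ ; finite = finite₀ ; qi = qᵢ
  ; isOut = isOut₀ ; δ = δ₀ }

{-# OPTIONS --safe #-}

-- From (↓,p) on a word 0ⁿ1u, D₀ runs a block that returns to (↑,p) on the same word:
-- rule (2) rotates the leading 0 to the back, the block of the opposite parity runs on
-- 0ⁿ⁻¹1u0, rule (4) turns the last 0 into 1, the block of the opposite parity runs on
-- 0ⁿ⁻¹1u1, and rule (5) restores 0ⁿ1u.  Since the outputs happen in (↓,Even) and (↑,Odd),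
-- by induction on n a block outputs each word 0ⁿ⁻ᵐ1uy with |y| = m ≤ n exactly once,
-- except that the Odd block omits m = 0.  Started on 0^ℓ, D₀ outputs 0^ℓ and then runs the
-- Even block on 0^(ℓ-1)1, so its first 2^ℓ outputs enumerate {0,1}^ℓ.  The delay is 1:
-- every state that is not an output state moves to one in a single step.
module Submission where

open import Defs

open import Data.Bool using (true; false)
open import Data.Empty using (⊥)
open import Data.List
  using (List; []; _∷_; _++_; [_]; length; map)
  renaming (replicate to replicateᴸ)
open import Data.List.Properties
  using (++-assoc; ++-identityʳ; ++-cancelˡ; ∷-injectiveʳ; map-++; map-∘; map-cong; length-++; length-map)
open import Data.List.Membership.Propositional using (_∈_; _∉_)
open import Data.List.Membership.Propositional.Properties using (∈-++⁺ˡ; ∈-++⁺ʳ; ∈-++⁻; ∈-map⁺; ∈-map⁻)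
import Data.List.Relation.Unary.All as All
open import Data.List.Relation.Unary.All.Properties using (¬Any⇒All¬)
open import Data.List.Relation.Unary.Any using (here; there)
open import Data.List.Relation.Unary.Unique.Propositional using (Unique; []; _∷_)
open import Data.List.Relation.Unary.Unique.Propositional.Properties as Unique using (++⁺; map⁻)
open import Data.Maybe using (just; _>>=_)
open import Data.Nat using (ℕ; zero; suc; _+_; _*_; _∸_; _^_; _≤_; _<_; s≤s)
open import Data.Nat.Properties
  using ( suc-injective; +-comm; *-suc; +-identityʳ; +-∸-assoc; n∸n≡0
        ; ≤-refl; ≤-reflexive; m≤m+n; n≤1+n; m≤n⇒m≤1+n)
open import Data.Product using (_×_; _,_; proj₁; ∃₂; ∃-syntax)
open import Data.Sum using (_⊎_; inj₁; inj₂)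
open import Data.Vec using (Vec; _∷_; _∷ʳ_; replicate; toList; initLast)
open import Data.Vec.Properties
  using (last-∷ʳ; init-∷ʳ; toList-∷ʳ; toList-replicate; toList-injective; length-toList; cast-is-id)
open import Function using (_∘_)
open import Relation.Binary.PropositionalEquality
  using (_≡_; refl; sym; trans; cong; cong₂; subst; module ≡-Reasoning)

zeros : ℕ → List Bit
zeros n = replicateᴸ n false

-- The block of parity p on 0ⁿu outputs pad n u y for y in suffixes n p, in this order.
pad : ℕ → List Bit → List Bit → List Bit
pad n u y = zeros (n ∸ length y) ++ u ++ y

branch : List (List Bit) → List (List Bit)
branch ys = map (false ∷_) ys ++ map (true ∷_) ys

suffixes : ℕ → Parity → List (List Bit)
suffixes zero    Even = [ [] ]
suffixes zero    Odd  = []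
suffixes (suc n) Even = [] ∷ branch (suffixes n Odd ++ [ [] ])
suffixes (suc n) Odd  = branch (suffixes n Even)

Enumerates : ℕ → List (List Bit) → Set
Enumerates n ws = length ws ≡ 2 ^ n × Unique ws × (∀ v → length v ≡ n → v ∈ ws)

enumeration : ℕ → List (List Bit)
enumeration k = zeros (suc k) ∷ map (pad k [ true ]) (suffixes k Even)

pad-[] : ∀ n u → pad n u [] ≡ zeros n ++ u
pad-[] n u = cong (zeros n ++_) (++-identityʳ u)

pad-∷ : ∀ n u b y → pad (suc n) u (b ∷ y) ≡ pad n (u ++ [ b ]) y
pad-∷ n u b y = cong (zeros (n ∸ length y) ++_) (sym (++-assoc u [ b ] y))

map-pad-∷ : ∀ n u b ys → map (pad (suc n) u) (map (b ∷_) ys) ≡ map (pad n (u ++ [ b ])) ys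
map-pad-∷ n u b ys = trans (sym (map-∘ ys)) (map-cong (pad-∷ n u b) ys)

map-pad-branch : ∀ n u ys ws →
  map (pad (suc n) u) (branch ys) ++ ws ≡ map (pad n (u ++ [ false ])) ys ++ (map (pad n (u ++ [ true ])) ys ++ ws)
map-pad-branch n u ys ws = begin
  map (pad (suc n) u) (map (false ∷_) ys ++ map (true ∷_) ys) ++ ws
    ≡⟨ cong (_++ ws) (map-++ (pad (suc n) u) (map (false ∷_) ys) _) ⟩
  (map (pad (suc n) u) (map (false ∷_) ys) ++ map (pad (suc n) u) (map (true ∷_) ys)) ++ ws
    ≡⟨ ++-assoc (map (pad (suc n) u) (map (false ∷_) ys)) _ ws ⟩
  map (pad (suc n) u) (map (false ∷_) ys) ++ (map (pad (suc n) u) (map (true ∷_) ys) ++ ws)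
    ≡⟨ cong₂ (λ as bs → as ++ (bs ++ ws)) (map-pad-∷ n u false ys) (map-pad-∷ n u true ys) ⟩
  map (pad n (u ++ [ false ])) ys ++ (map (pad n (u ++ [ true ])) ys ++ ws) ∎
  where open ≡-Reasoning

map-pad-++[] : ∀ n u ys ws → map (pad n u) (ys ++ [ [] ]) ++ ws ≡ map (pad n u) ys ++ (zeros n ++ u) ∷ ws
map-pad-++[] n u ys ws = begin
  map (pad n u) (ys ++ [ [] ]) ++ ws      ≡⟨ cong (_++ ws) (map-++ (pad n u) ys [ [] ]) ⟩
  (map (pad n u) ys ++ [ pad n u [] ]) ++ ws ≡⟨ ++-assoc (map (pad n u) ys) _ ws ⟩
  map (pad n u) ys ++ pad n u [] ∷ ws       ≡⟨ cong (λ w → map (pad n u) ys ++ w ∷ ws) (pad-[] n u) ⟩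
  map (pad n u) ys ++ (zeros n ++ u) ∷ ws   ∎
  where open ≡-Reasoning

map-pad-suffixes-Even : ∀ n u ws {w w₀ w₁} →
  w ≡ zeros (suc n) ++ u → w₀ ≡ zeros n ++ u ++ [ false ] → w₁ ≡ zeros n ++ u ++ [ true ] →
  let ys = suffixes n Odd in
  w ∷ (map (pad n (u ++ [ false ])) ys ++ w₀ ∷ (map (pad n (u ++ [ true ])) ys ++ w₁ ∷ ws))
    ≡ map (pad (suc n) u) (suffixes (suc n) Even) ++ ws
map-pad-suffixes-Even n u ws refl refl refl = cong₂ _∷_ (sym (pad-[] (suc n) u)) (sym (begin
  map (pad (suc n) u) (branch (ys ++ [ [] ])) ++ ws
    ≡⟨ map-pad-branch n u (ys ++ [ [] ]) ws ⟩
  map (pad n (u ++ [ false ])) (ys ++ [ [] ]) ++ (map (pad n (u ++ [ true ])) (ys ++ [ [] ]) ++ ws)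
    ≡⟨ map-pad-++[] n (u ++ [ false ]) ys _ ⟩
  map (pad n (u ++ [ false ])) ys ++ (zeros n ++ u ++ [ false ]) ∷ (map (pad n (u ++ [ true ])) (ys ++ [ [] ]) ++ ws)
    ≡⟨ cong (λ rest → map (pad n (u ++ [ false ])) ys ++ (zeros n ++ u ++ [ false ]) ∷ rest)
            (map-pad-++[] n (u ++ [ true ]) ys ws) ⟩
  map (pad n (u ++ [ false ])) ys ++ (zeros n ++ u ++ [ false ]) ∷
    (map (pad n (u ++ [ true ])) ys ++ (zeros n ++ u ++ [ true ]) ∷ ws) ∎))
  where
    open ≡-Reasoning
    ys = suffixes n Odd

∈-branch⁺ : ∀ b {y ys} → y ∈ ys → b ∷ y ∈ branch ys
∈-branch⁺ false y∈ = ∈-++⁺ˡ (∈-map⁺ (false ∷_) y∈)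
∈-branch⁺ true  y∈ = ∈-++⁺ʳ _ (∈-map⁺ (true ∷_) y∈)

[]∉map-∷ : ∀ b (ys : List (List Bit)) → [] ∉ map (b ∷_) ys
[]∉map-∷ b ys []∈ with ∈-map⁻ _ []∈
... | _ , _ , ()

[]∉branch : ∀ ys → [] ∉ branch ys
[]∉branch ys []∈ with ∈-++⁻ (map (false ∷_) ys) []∈
... | inj₁ []∈ˡ = []∉map-∷ false ys []∈ˡ
... | inj₂ []∈ʳ = []∉map-∷ true  ys []∈ʳ

branch⁺ : ∀ {ys} → Unique ys → Unique (branch ys)
branch⁺ {ys} u = ++⁺ (Unique.map⁺ ∷-injectiveʳ u) (Unique.map⁺ ∷-injectiveʳ u) disjoint
  where
    disjoint : ∀ {v} → v ∈ map (false ∷_) ys × v ∈ map (true ∷_) ys → ⊥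
    disjoint (v∈ˡ , v∈ʳ) with ∈-map⁻ (false ∷_) v∈ˡ | ∈-map⁻ (true ∷_) v∈ʳ
    ... | _ , _ , refl | _ , _ , ()

length-branch : ∀ ys → length (branch ys) ≡ 2 * length ys
length-branch ys = begin
  length (map (false ∷_) ys ++ map (true ∷_) ys)         ≡⟨ length-++ (map (false ∷_) ys) ⟩
  length (map (false ∷_) ys) + length (map (true ∷_) ys) ≡⟨ cong₂ _+_ (length-map _ ys) (length-map _ ys) ⟩
  length ys + length ys                                   ≡⟨ cong (length ys +_) (sym (+-identityʳ _)) ⟩
  2 * length ys                                           ∎
  where open ≡-Reasoning

[]∉suffixes-Odd : ∀ n → [] ∉ suffixes n Odd
[]∉suffixes-Odd zero    ()
[]∉suffixes-Odd (suc n) = []∉branch (suffixes n Even)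

suffixes-unique : ∀ n p → Unique (suffixes n p)
suffixes-unique zero    Even = All.[] ∷ []
suffixes-unique zero    Odd  = []
suffixes-unique (suc n) Even = ¬Any⇒All¬ _ ([]∉branch (suffixes n Odd ++ [ [] ])) ∷ branch⁺ snoc-unique
  where
    snoc-unique : Unique (suffixes n Odd ++ [ [] ])
    snoc-unique = ++⁺ (suffixes-unique n Odd) (All.[] ∷ [])
                      (λ { ([]∈ , here refl) → []∉suffixes-Odd n []∈ })
suffixes-unique (suc n) Odd  = branch⁺ (suffixes-unique n Even)

∈-suffixes-Even : ∀ n y → length y ≤ n → y ∈ suffixes n Even
∈-suffixes-Odd  : ∀ n b y → length y < n → b ∷ y ∈ suffixes n Odd

∈-suffixes-Even zero    []      _         = here refl
∈-suffixes-Even (suc n) []      _         = here refl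
∈-suffixes-Even (suc n) (b ∷ y) (s≤s y≤n) = there (∈-branch⁺ b (∈-snoc y y≤n))
  where
    ∈-snoc : ∀ y → length y ≤ n → y ∈ suffixes n Odd ++ [ [] ]
    ∈-snoc []      _   = ∈-++⁺ʳ _ (here refl)
    ∈-snoc (c ∷ y) y<n = ∈-++⁺ˡ (∈-suffixes-Odd n c y y<n)

∈-suffixes-Odd (suc n) b y (s≤s y≤n) = ∈-branch⁺ b (∈-suffixes-Even n y y≤n)

length-suffixes-Even : ∀ n → suc (length (suffixes n Even)) ≡ 2 ^ suc n
length-suffixes-Odd  : ∀ n → suc (suc (length (suffixes n Odd))) ≡ 2 ^ suc n

length-suffixes-Even zero    = refl
length-suffixes-Even (suc n) = begin
  suc (suc (length (branch (ys ++ [ [] ]))))  ≡⟨ cong (suc ∘ suc) (length-branch (ys ++ [ [] ])) ⟩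
  suc (suc (2 * length (ys ++ [ [] ])))       ≡⟨ cong (λ l → suc (suc (2 * l))) (trans (length-++ ys) (+-comm _ 1)) ⟩
  suc (suc (2 * suc (length ys)))             ≡⟨ sym (*-suc 2 (suc (length ys))) ⟩
  2 * suc (suc (length ys))                   ≡⟨ cong (2 *_) (length-suffixes-Odd n) ⟩
  2 ^ suc (suc n)                             ∎
  where
    open ≡-Reasoning
    ys = suffixes n Odd

length-suffixes-Odd zero    = refl
length-suffixes-Odd (suc n) = begin
  suc (suc (length (branch ys)))  ≡⟨ cong (suc ∘ suc) (length-branch ys) ⟩
  suc (suc (2 * length ys))       ≡⟨ sym (*-suc 2 (length ys)) ⟩
  2 * suc (length ys)             ≡⟨ cong (2 *_) (length-suffixes-Even n) ⟩
  2 ^ suc (suc n)                 ∎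
  where
    open ≡-Reasoning
    ys = suffixes n Even

zeros-++-true-injective : ∀ i j {s t} → zeros i ++ true ∷ s ≡ zeros j ++ true ∷ t → s ≡ t
zeros-++-true-injective zero    zero    eq = ∷-injectiveʳ eq
zeros-++-true-injective (suc i) (suc j) eq = zeros-++-true-injective i j (∷-injectiveʳ eq)
zeros-++-true-injective zero    (suc j) ()
zeros-++-true-injective (suc i) zero    ()

zeros≢zeros-++-true : ∀ n j {s} → zeros n ≡ zeros j ++ true ∷ s → ⊥
zeros≢zeros-++-true zero    zero    ()
zeros≢zeros-++-true zero    (suc j) ()
zeros≢zeros-++-true (suc n) zero    ()
zeros≢zeros-++-true (suc n) (suc j) eq = zeros≢zeros-++-true n j (∷-injectiveʳ eq)

pad-injective : ∀ n u {y y′} → pad n (true ∷ u) y ≡ pad n (true ∷ u) y′ → y ≡ y′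
pad-injective n u {y} {y′} eq =
  ++-cancelˡ u y y′ (zeros-++-true-injective (n ∸ length y) (n ∸ length y′) eq)

zeros-or-pad : ∀ k v → length v ≡ suc k →
               v ≡ zeros (suc k) ⊎ ∃[ y ] (length y ≤ k × v ≡ pad k [ true ] y)
zeros-or-pad .(length y) (true ∷ y) refl =
  inj₂ (y , ≤-refl , cong (λ i → zeros i ++ true ∷ y) (sym (n∸n≡0 (length y))))
zeros-or-pad zero    (false ∷ []) refl = inj₁ refl
zeros-or-pad (suc k) (false ∷ v) len with zeros-or-pad k v (suc-injective len)
... | inj₁ v≡zeros        = inj₁ (cong (false ∷_) v≡zeros)
... | inj₂ (y , y≤k , v≡) = inj₂ (y , m≤n⇒m≤1+n y≤k ,
  trans (cong (false ∷_) v≡) (cong (λ i → zeros i ++ true ∷ y) (sym (+-∸-assoc 1 y≤k))))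

enumeration-enumerates : ∀ k → Enumerates (suc k) (enumeration k)
enumeration-enumerates k = length-enumeration , unique , complete
  where
    length-enumeration : length (enumeration k) ≡ 2 ^ suc k
    length-enumeration = trans (cong suc (length-map _ (suffixes k Even))) (length-suffixes-Even k)

    zeros∉pads : zeros (suc k) ∉ map (pad k [ true ]) (suffixes k Even)
    zeros∉pads zeros∈ with y , _ , zeros≡ ← ∈-map⁻ (pad k [ true ]) zeros∈ =
      zeros≢zeros-++-true (suc k) (k ∸ length y) zeros≡

    unique : Unique (enumeration k)
    unique = ¬Any⇒All¬ _ zeros∉pads ∷ Unique.map⁺ (pad-injective k []) (suffixes-unique k Even)

    complete : ∀ v → length v ≡ suc k → v ∈ enumeration k
    complete v len with zeros-or-pad k v len
    ... | inj₁ refl              = here refl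
    ... | inj₂ (y , y≤k , refl) = there (∈-map⁺ (pad k [ true ]) (∈-suffixes-Even k y y≤k))

toList-injective-≡ : ∀ {n} (xs ys : Vec Bit n) → toList xs ≡ toList ys → xs ≡ ys
toList-injective-≡ xs ys eq = trans (sym (cast-is-id refl xs)) (toList-injective refl xs ys eq)

module Runs (M : DequeMachine) where
  open DequeMachine M

  emitted : ∀ {k} → Config M k → List (List Bit)
  emitted c = map toList (producedAt M (just c))

  -- c ⇒⟨ ws ⟩ c′ : the machine goes from c to c′, and ws lists (as lists) the
  -- words it outputs on the way, at c included and at c′ excluded.
  infixr 5 _◅_
  data _⇒⟨_⟩_ {k} : Config M k → List (List Bit) → Config M k → Set where
    ε   : ∀ {c} → c ⇒⟨ [] ⟩ c
    _◅_ : ∀ {c c′ c″ ws} → step M c ≡ just c′ → c′ ⇒⟨ ws ⟩ c″ → c ⇒⟨ emitted c ++ ws ⟩ c″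

  ⇒-cast : ∀ {k} {c c′ : Config M k} {ws ws′} → ws ≡ ws′ → c ⇒⟨ ws ⟩ c′ → c ⇒⟨ ws′ ⟩ c′
  ⇒-cast refl d = d

  start : ∀ k → Config M k
  start k = qi , replicate (suc k) false

  run-⇒ : ∀ {k t c c′ ws ws′} → run M k t ≡ just c → map toList (outputs M k t) ≡ ws →
          c ⇒⟨ ws′ ⟩ c′ → ∃[ t′ ] map toList (outputs M k t′) ≡ ws ++ ws′
  run-⇒ {t = t} _ outs ε = t , trans outs (sym (++-identityʳ _))
  run-⇒ {k} {t} {c} {ws = ws} r outs (_◅_ {ws = ws′} s d) =
    let t′ , outs′ = run-⇒ {t = suc t} (trans (cong (_>>= step M) r) s) outs-suc d
    in  t′ , trans outs′ (++-assoc ws (emitted c) ws′)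
    where
      outs-suc : map toList (outputs M k t ++ producedAt M (run M k t)) ≡ ws ++ emitted c
      outs-suc = trans (map-++ toList (outputs M k t) _)
                       (cong₂ _++_ outs (cong (map toList ∘ producedAt M) r))

  prefix-enumerated : ∀ {k ws c} → Enumerates (suc k) ws → start k ⇒⟨ ws ⟩ c →
    ∃[ t ] (length (outputs M k t) ≡ 2 ^ suc k × Unique (outputs M k t) × (∀ w → w ∈ outputs M k t))
  prefix-enumerated {k} (len , unique , complete) d =
    let t , outs = run-⇒ {t = 0} refl refl d in
    t , trans (sym (length-map toList (outputs M k t))) (trans (cong length outs) len)
      , map⁻ (subst Unique (sym outs) unique)
      , λ w → let w′ , w′∈ , w≡w′ = ∈-map⁻ toList (subst (toList w ∈_) (sym outs)
                                                          (complete (toList w) (length-toList w)))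
              in subst (_∈ outputs M k t) (sym (toList-injective-≡ w w′ w≡w′)) w′∈

  constantDelay : (∀ {k} (c : Config M k) → isOut (proj₁ c) ≡ false →
                   ∃[ c′ ] (step M c ≡ just c′ × isOut (proj₁ c′) ≡ true)) →
                  ConstantDelay M
  constantDelay next = 1 , output-within-one-step
    where
      output-within-one-step : ∀ k t → Alive M k t →
                               ∃[ s ] (t ≤ s × s ≤ t + 1 × (OutputAt M k s ⊎ HaltedAt M k s))
      output-within-one-step k t ((q , w) , r) with isOut q in out
      ... | true  = t , ≤-refl , m≤m+n t 1 , inj₁ (q , w , r , out)
      ... | false =
        let (q′ , w′) , s , out′ = next (q , w) out
        in  suc t , n≤1+n t , ≤-reflexive (+-comm 1 t)
          , inj₁ (q′ , w′ , trans (cong (_>>= step M) r) s , out′)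

open Runs D₀

replicate-∷ʳ : ∀ {A : Set} n (x : A) → replicate (suc n) x ≡ replicate n x ∷ʳ x
replicate-∷ʳ zero    x = refl
replicate-∷ʳ (suc n) x = cong (x ∷_) (replicate-∷ʳ n x)

toList-rotate : ∀ {m} n (xs : Vec Bit m) b {r} → toList (false ∷ xs) ≡ zeros (suc n) ++ r →
                toList (xs ∷ʳ b) ≡ zeros n ++ r ++ [ b ]
toList-rotate n xs b {r} eq =
  trans (toList-∷ʳ b xs) (trans (cong (_++ [ b ]) (∷-injectiveʳ eq)) (++-assoc (zeros n) r [ b ]))

module _ {k : ℕ} where

  step-qᵢ : step D₀ (qᵢ , replicate (suc k) false) ≡ just (st ↓ Even , replicate k false ∷ʳ true)
  step-qᵢ rewrite replicate-∷ʳ k false | last-∷ʳ false (replicate k false)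
                | init-∷ʳ false (replicate k false) = refl

  step-↑0 : ∀ p (v : Vec Bit k) → step D₀ (st ↑ p , v ∷ʳ false) ≡ just (st ↓ p , v ∷ʳ true)
  step-↑0 p v rewrite last-∷ʳ false v | init-∷ʳ false v = refl

  step-↑1 : ∀ p (v : Vec Bit k) → step D₀ (st ↑ p , v ∷ʳ true) ≡ just (st ↑ (flip p) , false ∷ v)
  step-↑1 p v rewrite last-∷ʳ true v | init-∷ʳ true v = refl

  next-output : (c : Config D₀ k) → isOut₀ (proj₁ c) ≡ false →
                ∃[ c′ ] (step D₀ c ≡ just c′ × isOut₀ (proj₁ c′) ≡ true)
  next-output (st ↓ Odd , false ∷ v) _ = _ , refl , refl
  next-output (st ↓ Odd , true  ∷ v) _ = _ , refl , refl
  next-output (st ↑ Even , w) _ = from-↑ (initLast w)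
    where
      from-↑ : ∃₂ (λ v b → w ≡ v ∷ʳ b) →
               ∃[ c′ ] (step D₀ (st ↑ Even , w) ≡ just c′ × isOut₀ (proj₁ c′) ≡ true)
      from-↑ (v , false , refl) = _ , step-↑0 Even v , refl
      from-↑ (v , true  , refl) = _ , step-↑1 Even v , refl

  block : ∀ n p u (w : Vec Bit (suc k)) {ws c} → toList w ≡ zeros n ++ true ∷ u →
          (st ↑ p , w) ⇒⟨ ws ⟩ c → (st ↓ p , w) ⇒⟨ map (pad n (true ∷ u)) (suffixes n p) ++ ws ⟩ c
  block zero    Even u (true ∷ xs) {ws} eq d = ⇒-cast (cong (_∷ ws) (trans eq (sym (pad-[] 0 _)))) (refl ◅ d)
  block zero    Odd  u (true ∷ xs)  eq d = refl ◅ d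
  block (suc n) Even u (false ∷ xs) {ws} eq d =
    ⇒-cast (map-pad-suffixes-Even n (true ∷ u) ws eq (toList-rotate n xs false eq) (toList-rotate n xs true eq))
      (refl ◅ block n Odd (u ++ [ false ]) (xs ∷ʳ false) (toList-rotate n xs false eq)
        (step-↑0 Odd xs ◅ block n Odd (u ++ [ true ]) (xs ∷ʳ true) (toList-rotate n xs true eq)
          (step-↑1 Odd xs ◅ d)))
  block (suc n) Odd  u (false ∷ xs) {ws} eq d =
    ⇒-cast (sym (map-pad-branch n (true ∷ u) (suffixes n Even) ws))
      (refl ◅ block n Even (u ++ [ false ]) (xs ∷ʳ false) (toList-rotate n xs false eq)
        (step-↑0 Even xs ◅ block n Even (u ++ [ true ]) (xs ∷ʳ true) (toList-rotate n xs true eq)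
          (step-↑1 Even xs ◅ d)))

  run-D₀ : start k ⇒⟨ enumeration k ⟩ (st ↑ Even , replicate k false ∷ʳ true)
  run-D₀ = ⇒-cast (cong₂ _∷_ (toList-replicate (suc k) false) (++-identityʳ _))
             (step-qᵢ ◅ block k Even [] _ first-word ε)
    where
      first-word : toList (replicate k false ∷ʳ true) ≡ zeros k ++ [ true ]
      first-word = trans (toList-∷ʳ true _) (cong (_++ [ true ]) (toList-replicate k false))

proposition6 : ConstantDelay D₀ × PrefixHamiltonian D₀
proposition6 = constantDelay next-output , λ k → prefix-enumerated (enumeration-enumerates k) run-D₀
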